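{- The rewriting system $\upsilon''$ is strongly normalizing.
   Context: Named variables $x,y,z,\ldots$ ($\mathsf{x}$ ranges over them). Terms and substitutions of $\upsilon''$: $a,b::=\mathsf{x}\mid\underline{1}\mid ab\mid\lambda a\mid\underline{\boldsymbol{\lambda}}\,a\mid s\circ a$, $s::=[b/]\mid W\mid id\mid\,\Uparrow\! s$, where $\underline{\boldsymbol{\lambda}}$ is a second abstraction constructor distinct from $\lambda$. Conventions: $s\circ t\circ a$ means $s\circ(t\circ a)$, $s\circ ab$ means $s\circ(ab)$, $\lambda\Uparrow\! s\circ a$ means $\lambda((\Uparrow\! s)\circ a)$, similarly for $\underline{\boldsymbol{\lambda}}$. The rules, applicable to any subterm (including inside $[b/]$ and $\Uparrow\! s$), are: $s\circ ab\to(s\circ a)(s\circ b)$; $s\circ\lambda a\to\lambda\Uparrow\! s\circ a$; $s\circ\lambda a\to\underline{\boldsymbol{\lambda}}\Uparrow\! s\circ a$; $s\circ\underline{\boldsymbol{\lambda}}a\to\lambda\Uparrow\! s\circ a$; $s\circ\underline{\boldsymbol{\lambda}}a\to\underline{\boldsymbol{\lambda}}\Uparrow\! s\circ a$; $[b/]\circ\underline{1}\to b$; $[b/]\circ W\circ a\to a$; $id\circ\underline{1}\to\underline{1}$; $id\circ W\circ a\to W\circ a$; $\Uparrow\! s\circ\underline{1}\to\underline{1}$; $\Uparrow\! s\circ W\circ a\to W\circ s\circ a$; $\underline{\boldsymbol{\lambda}}a\to\lambda\,id\circ a$; $\underline{\boldsymbol{\lambda}}a\to\lambda a$. -}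

module Defs where

open import Data.Nat using (ℕ)
open import Induction.WellFounded using (Acc)

-- Named variables x, y, z, ... are represented by natural numbers.
Var : Set
Var = ℕ

mutual
  data Term : Set where
    var  : Var → Term
    one  : Term                      -- the de Bruijn index 1 (underlined)
    app  : Term → Term → Term
    lam  : Term → Term
    lam' : Term → Term
    _∘_  : Subst → Term → Term

  data Subst : Set where
    [_/] : Term → Subst
    W    : Subst
    idS  : Subst
    ⇑_   : Subst → Subst

infixr 5 _∘_

mutual
  data _⟶_ : Term → Term → Set where
    r-app     : ∀ s a b → (s ∘ app a b) ⟶ app (s ∘ a) (s ∘ b)
    r-lam-lam : ∀ s a → (s ∘ lam a) ⟶ lam ((⇑ s) ∘ a)
    r-lam-lam' : ∀ s a → (s ∘ lam a) ⟶ lam' ((⇑ s) ∘ a)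
    r-lam'-lam : ∀ s a → (s ∘ lam' a) ⟶ lam ((⇑ s) ∘ a)
    r-lam'-lam' : ∀ s a → (s ∘ lam' a) ⟶ lam' ((⇑ s) ∘ a)
    r-sub-one : ∀ b → ([ b /] ∘ one) ⟶ b
    r-sub-W   : ∀ b a → ([ b /] ∘ W ∘ a) ⟶ a
    r-id-one  : (idS ∘ one) ⟶ one
    r-id-W    : ∀ a → (idS ∘ W ∘ a) ⟶ (W ∘ a)
    r-lift-one : ∀ s → ((⇑ s) ∘ one) ⟶ one
    r-lift-W  : ∀ s a → ((⇑ s) ∘ W ∘ a) ⟶ (W ∘ s ∘ a)
    r-lam'-id : ∀ a → lam' a ⟶ lam (idS ∘ a)
    r-lam'    : ∀ a → lam' a ⟶ lam a
    c-appˡ  : ∀ {a a'} b → a ⟶ a' → app a b ⟶ app a' b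
    c-appʳ  : ∀ a {b b'} → b ⟶ b' → app a b ⟶ app a b'
    c-lam   : ∀ {a a'} → a ⟶ a' → lam a ⟶ lam a'
    c-lam'  : ∀ {a a'} → a ⟶ a' → lam' a ⟶ lam' a'
    c-∘ˡ    : ∀ {s s'} a → s ⟶ₛ s' → (s ∘ a) ⟶ (s' ∘ a)
    c-∘ʳ    : ∀ s {a a'} → a ⟶ a' → (s ∘ a) ⟶ (s ∘ a')

  data _⟶ₛ_ : Subst → Subst → Set where
    c-sub  : ∀ {b b'} → b ⟶ b' → [ b /] ⟶ₛ [ b' /]
    c-lift : ∀ {s s'} → s ⟶ₛ s' → (⇑ s) ⟶ₛ (⇑ s')

SN : Term → Set
SN = Acc (λ b a → a ⟶ b)

SNₛ : Subst → Set
SNₛ = Acc (λ t s → s ⟶ₛ t)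

module Submission where

-- Strong normalisation of υ'' by a lexicographic interpretation.
--
-- Every term a receives a weight (μ a , ν a) consisting of a number μ a
-- and a family of numbers ν a m indexed by ℕ.  Weights are ordered
-- lexicographically: first by μ, then pointwise by ν.  This order is
-- well-founded (it embeds into the lexicographic order on ℕ × ℕ by
-- evaluating the family at 0), so it suffices to show that every
-- one-step reduction strictly decreases the weight; substitutions are
-- treated in the same way with a weight (σ s , νs s).
--
-- μ is a polynomial interpretation in which s ∘ a weighs (1 + σ s)·μ a
-- and id weighs nothing.  It never increases, and it strictly decreases
-- when a substitution of positive weight is pushed inwards or discarded.
-- The family ν handles the remaining steps, which only involve
-- identity-like substitutions ⇑ⁿ id: in ν a m the index m grows under
-- each s ∘ _, so an occurrence of 1 or W sitting under many closures is
-- expensive, and λ̲ is made heavier than λ.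

open import Defs
open import Data.Product using (_×_; _,_)
open import Data.Sum using (inj₁; inj₂)
open import Data.Nat using (ℕ; zero; suc; _+_; _*_; _≤_; _<_; z≤n; s≤s; NonZero; >-nonZero⁻¹)
open import Data.Nat.Properties
open import Data.Nat.Induction using (<-wellFounded)
open import Data.Nat.Tactic.RingSolver using (solve-∀)
open import Data.Product.Relation.Binary.Lex.Strict using (×-Lex; ×-wellFounded)
open import Function using (_on_)
open import Induction.WellFounded using (WellFounded; module Subrelation)
open import Relation.Binary.Definitions using (Monotonic₁)
open import Relation.Binary.PropositionalEquality using (_≡_; refl; sym; trans; cong; cong₂)
import Relation.Binary.Construct.On as On

Weight : Set
Weight = ℕ × (ℕ → ℕ)

_<ᵖ_ : (ℕ → ℕ) → (ℕ → ℕ) → Set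
f <ᵖ g = ∀ m → f m < g m

_⊏_ : Weight → Weight → Set
_⊏_ = ×-Lex _≡_ _<_ _<ᵖ_

<ᵖ-wellFounded : WellFounded _<ᵖ_
<ᵖ-wellFounded =
  Subrelation.wellFounded (λ f<g → f<g 0) (On.wellFounded (λ f → f 0) <-wellFounded)

⊏-wellFounded : WellFounded _⊏_
⊏-wellFounded = ×-wellFounded <-wellFounded <ᵖ-wellFounded

⊏-weak-strict : ∀ {x y f g} → x ≤ y → f <ᵖ g → (x , f) ⊏ (y , g)
⊏-weak-strict x≤y f<g with m≤n⇒m<n∨m≡n x≤y
... | inj₁ x<y = inj₁ x<y
... | inj₂ x≡y = inj₂ (x≡y , f<g)

-- Compatibility with contexts: a context acts on weights by a strictly
-- monotone map F on the first component and, at index m, by a strictly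
-- monotone map H m applied to the family at a shifted index k m.
⊏-compat : (F : ℕ → ℕ) (H : ℕ → ℕ → ℕ) (k : ℕ → ℕ) →
           Monotonic₁ _<_ _<_ F → (∀ m → Monotonic₁ _<_ _<_ (H m)) →
           ∀ {x y f g} → (x , f) ⊏ (y , g) →
           (F x , λ m → H m (f (k m))) ⊏ (F y , λ m → H m (g (k m)))
⊏-compat F H k F-mono H-mono (inj₁ x<y)         = inj₁ (F-mono x<y)
⊏-compat F H k F-mono H-mono (inj₂ (refl , f<g)) = inj₂ (refl , λ m → H-mono m (f<g (k m)))

mutual
  μ : Term → ℕ
  μ (var x)   = 1
  μ one       = 1
  μ (app a b) = suc (μ a + μ b)
  μ (lam a)   = suc (μ a)
  μ (lam' a)  = suc (μ a)
  μ (s ∘ a)   = suc (σ s) * μ a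

  σ : Subst → ℕ
  σ [ b /] = suc (μ b)
  σ W      = 1
  σ idS    = 0
  σ (⇑ s)  = σ s

double : ℕ → ℕ
double zero    = zero
double (suc m) = suc (suc (double m))

double-mono : ∀ {m n} → m ≤ n → double m ≤ double n
double-mono z≤n     = z≤n
double-mono (s≤s p) = s≤s (s≤s (double-mono p))

mutual
  ν : Term → ℕ → ℕ
  ν (var x)   m = 1
  ν one       m = suc m
  ν (app a b) m = ν a m + ν b m + suc m
  ν (lam a)   m = ν a (double m) + suc (double m)
  ν (lam' a)  m = ν a (suc (double m)) + suc (suc (double m))
  ν (s ∘ a)   m = ν a (suc m) + νs s m

  νs : Subst → ℕ → ℕ
  νs [ b /] m = suc (ν b 0)
  νs W      m = m
  νs idS    m = 0
  νs (⇑ s)  m = νs s (suc m)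

weight : Term → Weight
weight a = μ a , ν a

weightₛ : Subst → Weight
weightₛ s = σ s , νs s

_≺_ : Term → Term → Set
_≺_ = _⊏_ on weight

_≺ₛ_ : Subst → Subst → Set
_≺ₛ_ = _⊏_ on weightₛ

μ-nonZero : ∀ a → NonZero (μ a)
μ-nonZero (var x)   = _
μ-nonZero one       = _
μ-nonZero (app a b) = _
μ-nonZero (lam a)   = _
μ-nonZero (lam' a)  = _
μ-nonZero (s ∘ a)   = m*n≢0 (suc (σ s)) (μ a) {{_}} {{μ-nonZero a}}

∘-heavier : ∀ s a → 0 < σ s → μ a < μ (s ∘ a)
∘-heavier s a σ>0 = m<m+n (μ a) (<-≤-trans σ>0 (m≤m*n (σ s) (μ a) {{μ-nonZero a}}))

σ-below : ∀ s a → σ s < μ (s ∘ a)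
σ-below s a =
  ≤-<-trans (m≤m*n (σ s) (μ a) {{μ-nonZero a}}) (m<n+m _ (>-nonZero⁻¹ (μ a) {{μ-nonZero a}}))

mutual
  ν-mono : ∀ a {m n} → m ≤ n → ν a m ≤ ν a n
  ν-mono (var x)   p = ≤-refl
  ν-mono one       p = s≤s p
  ν-mono (app a b) p = +-mono-≤ (+-mono-≤ (ν-mono a p) (ν-mono b p)) (s≤s p)
  ν-mono (lam a)   p = +-mono-≤ (ν-mono a (double-mono p)) (s≤s (double-mono p))
  ν-mono (lam' a)  p = +-mono-≤ (ν-mono a (s≤s (double-mono p))) (s≤s (s≤s (double-mono p)))
  ν-mono (s ∘ a)   p = +-mono-≤ (ν-mono a (s≤s p)) (νs-mono s p)

  νs-mono : ∀ s {m n} → m ≤ n → νs s m ≤ νs s n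
  νs-mono [ b /] p = ≤-refl
  νs-mono W      p = p
  νs-mono idS    p = ≤-refl
  νs-mono (⇑ s)  p = νs-mono s (s≤s p)

-- Substitutions of weight 0 (the liftings ⇑ⁿ id) are invisible to ν.
νs-vanishes : ∀ s → σ s ≡ 0 → ∀ m → νs s m ≡ 0
νs-vanishes idS   _    m = refl
νs-vanishes (⇑ s) σ≡0 m = νs-vanishes s σ≡0 (suc m)

-- Pushing a substitution of μ-weight 1 + c inside a constructor of μ-weight
-- 1 + x turns (1 + c)(1 + x) into 1 + (1 + c)x.  This is a strict decrease
-- unless c = 0, in which case the families have to decrease.
push-decreases : ∀ c x {y z f g} → y ≡ suc c * suc x → z ≡ suc (suc c * x) →
                 (c ≡ 0 → g <ᵖ f) → (z , g) ⊏ (y , f)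
push-decreases zero    x y≡ z≡ g<f = inj₂ (trans z≡ (sym y≡) , g<f refl)
push-decreases (suc c) x {y} {z} y≡ z≡ _ = inj₁ (begin-strict
  z                                 ≡⟨ z≡ ⟩
  suc (suc (suc c) * x)             <⟨ s≤s (s≤s (m≤n+m _ c)) ⟩
  suc (suc c) + suc (suc c) * x     ≡⟨ sym (*-suc (suc (suc c)) x) ⟩
  suc (suc c) * suc x               ≡⟨ sym y≡ ⟩
  y                                 ∎)
  where open ≤-Reasoning

app-ν-decreases : ∀ s a b → σ s ≡ 0 → ν (app (s ∘ a) (s ∘ b)) <ᵖ ν (s ∘ app a b)
app-ν-decreases s a b σ≡0 m = begin-strict
  x + νs s m + (y + νs s m) + suc m  ≡⟨ cong₂ (λ u v → x + u + (y + v) + suc m) vanish vanish ⟩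
  x + 0 + (y + 0) + suc m            ≡⟨ cong₂ (λ u v → u + v + suc m) (+-identityʳ x) (+-identityʳ y) ⟩
  x + y + suc m                      <⟨ +-monoʳ-< (x + y) (n<1+n (suc m)) ⟩
  x + y + suc (suc m)                ≡⟨ sym (+-identityʳ _) ⟩
  x + y + suc (suc m) + 0            ≡⟨ cong (x + y + suc (suc m) +_) (sym vanish) ⟩
  x + y + suc (suc m) + νs s m       ∎
  where
  open ≤-Reasoning
  x = ν a (suc m)
  y = ν b (suc m)
  vanish = νs-vanishes s σ≡0 m

-- ν-decrease when an identity-like s is pushed under a binder: the body is
-- evaluated at no larger index and the binder's own contribution drops.
binder-ν-decreases : ∀ s a {k i j j'} m → σ s ≡ 0 → suc k ≤ i → j < j' →
                     ν ((⇑ s) ∘ a) k + j < ν a i + j' + νs s m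
binder-ν-decreases s a {k} {i} {j} {j'} m σ≡0 k<i j<j' = begin-strict
  ν a (suc k) + νs s (suc k) + j  ≡⟨ cong (λ u → ν a (suc k) + u + j) (νs-vanishes s σ≡0 (suc k)) ⟩
  ν a (suc k) + 0 + j             ≡⟨ cong (_+ j) (+-identityʳ _) ⟩
  ν a (suc k) + j                 <⟨ +-mono-≤-< (ν-mono a k<i) j<j' ⟩
  ν a i + j'                      ≡⟨ sym (+-identityʳ _) ⟩
  ν a i + j' + 0                  ≡⟨ cong (ν a i + j' +_) (sym (νs-vanishes s σ≡0 m)) ⟩
  ν a i + j' + νs s m             ∎
  where open ≤-Reasoning

app-decreases : ∀ s a b → app (s ∘ a) (s ∘ b) ≺ (s ∘ app a b)
app-decreases s a b =
  push-decreases (σ s) (μ a + μ b) refl (cong suc (sym (*-distribˡ-+ (suc (σ s)) (μ a) (μ b))))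
    (app-ν-decreases s a b)

-- id ∘ W ∘ a → W ∘ a: μ is unchanged and the index of a drops.
id-W-decreases : ∀ a → (W ∘ a) ≺ (idS ∘ W ∘ a)
id-W-decreases a = ⊏-weak-strict (≤-reflexive (sym (*-identityˡ (2 * μ a)))) λ m →
  ≤-trans (+-mono-≤-< (ν-mono a (n≤1+n _)) (n<1+n m)) (m≤m+n _ 0)

lift-one-decreases : ∀ s → one ≺ ((⇑ s) ∘ one)
lift-one-decreases s = ⊏-weak-strict (>-nonZero⁻¹ _ {{μ-nonZero ((⇑ s) ∘ one)}}) λ m →
  s≤s (s≤s (m≤m+n m _))

-- ⇑ s ∘ W ∘ a → W ∘ s ∘ a: μ is unchanged and the contribution m + 1 of W
-- drops to m.
lift-W-decreases : ∀ s a → (W ∘ s ∘ a) ≺ ((⇑ s) ∘ W ∘ a)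
lift-W-decreases s a = inj₂ (sym (μ-reorder (σ s) (μ a)) , λ m →
  ≤-reflexive (ν-reorder (ν a (suc (suc m))) (νs s (suc m)) m))
  where
  μ-reorder : ∀ c x → suc c * (2 * x) ≡ 2 * (suc c * x)
  μ-reorder = solve-∀
  ν-reorder : ∀ x y m → suc (x + y + m) ≡ x + suc m + y
  ν-reorder = solve-∀

-- λ̲ a → λ (id ∘ a): μ is unchanged and λ̲ outweighs λ in ν.
lam'-id-decreases : ∀ a → lam (idS ∘ a) ≺ lam' a
lam'-id-decreases a = ⊏-weak-strict (≤-reflexive (cong suc (*-identityˡ (μ a)))) λ m →
  +-mono-≤-< (≤-reflexive (+-identityʳ (ν a (suc (double m))))) (n<1+n _)

-- The four binder rules are
-- instances of push-decreases, the two rules discarding [b/] drop μ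
-- outright, and each congruence is an instance of ⊏-compat.
mutual
  step-decreases : ∀ {a b} → a ⟶ b → b ≺ a
  step-decreases (r-app s a b) = app-decreases s a b
  step-decreases (r-lam-lam s a) = push-decreases (σ s) (μ a) refl refl λ σ≡0 m →
    binder-ν-decreases s a m σ≡0 (n≤1+n _) (s≤s (s≤s (n≤1+n _)))
  step-decreases (r-lam-lam' s a) = push-decreases (σ s) (μ a) refl refl λ σ≡0 m →
    binder-ν-decreases s a m σ≡0 ≤-refl ≤-refl
  step-decreases (r-lam'-lam s a) = push-decreases (σ s) (μ a) refl refl λ σ≡0 m →
    binder-ν-decreases s a m σ≡0 (m≤n+m _ 2) (s≤s (m≤n+m _ 2))
  step-decreases (r-lam'-lam' s a) = push-decreases (σ s) (μ a) refl refl λ σ≡0 m →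
    binder-ν-decreases s a m σ≡0 (n≤1+n _) (n≤1+n _)
  step-decreases (r-sub-one b) = inj₁ (<-trans (n<1+n (μ b)) (σ-below [ b /] one))
  step-decreases (r-sub-W b a) = inj₁ (<-trans (∘-heavier W a (s≤s z≤n)) (∘-heavier [ b /] (W ∘ a) (s≤s z≤n)))
  step-decreases r-id-one = inj₂ (refl , λ m → s≤s (s≤s (m≤m+n m 0)))
  step-decreases (r-id-W a) = id-W-decreases a
  step-decreases (r-lift-one s) = lift-one-decreases s
  step-decreases (r-lift-W s a) = lift-W-decreases s a
  step-decreases (r-lam'-id a) = lam'-id-decreases a
  step-decreases (r-lam' a) = inj₂ (refl , λ m → +-mono-≤-< (ν-mono a (n≤1+n _)) (n<1+n _))
  step-decreases (c-appˡ b p) = ⊏-compat (λ z → suc (z + μ b)) (λ m z → z + ν b m + suc m) (λ m → m)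
    (λ l → s≤s (+-monoˡ-< (μ b) l)) (λ m l → +-monoˡ-< (suc m) (+-monoˡ-< (ν b m) l))
    (step-decreases p)
  step-decreases (c-appʳ a p) = ⊏-compat (λ z → suc (μ a + z)) (λ m z → ν a m + z + suc m) (λ m → m)
    (λ l → s≤s (+-monoʳ-< (μ a) l)) (λ m l → +-monoˡ-< (suc m) (+-monoʳ-< (ν a m) l))
    (step-decreases p)
  step-decreases (c-lam p) = ⊏-compat suc (λ m z → z + suc (double m)) double
    s≤s (λ m → +-monoˡ-< _) (step-decreases p)
  step-decreases (c-lam' p) = ⊏-compat suc (λ m z → z + suc (suc (double m))) (λ m → suc (double m))
    s≤s (λ m → +-monoˡ-< _) (step-decreases p)
  step-decreases (c-∘ˡ a p) = ⊏-compat (λ z → suc z * μ a) (λ m z → ν a (suc m) + z) (λ m → m)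
    (λ l → *-monoˡ-< (μ a) {{μ-nonZero a}} (s≤s l)) (λ m → +-monoʳ-< (ν a (suc m)))
    (stepₛ-decreases p)
  step-decreases (c-∘ʳ s p) = ⊏-compat (suc (σ s) *_) (λ m z → z + νs s m) suc
    (*-monoʳ-< (suc (σ s))) (λ m → +-monoˡ-< (νs s m)) (step-decreases p)

  stepₛ-decreases : ∀ {s t} → s ⟶ₛ t → t ≺ₛ s
  stepₛ-decreases (c-sub p) = ⊏-compat suc (λ m z → suc z) (λ m → 0)
    s≤s (λ m → s≤s) (step-decreases p)
  stepₛ-decreases (c-lift p) = ⊏-compat (λ z → z) (λ m z → z) suc
    (λ l → l) (λ m l → l) (stepₛ-decreases p)

mainTheorem19 : (∀ (a : Term) → SN a) × (∀ (s : Subst) → SNₛ s)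
mainTheorem19 =
    Subrelation.wellFounded step-decreases (On.wellFounded weight ⊏-wellFounded)
  , Subrelation.wellFounded stepₛ-decreases (On.wellFounded weightₛ ⊏-wellFounded)
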